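{- Let $k,t$ be positive integers, $I_k=\{i\in\mathbb{Z}:-k\le i\le k\}$ and $D(I_k)=\max\{2,2k-1\}$. If $\mathsf{s}'_t(I_k)$ is finite, then every odd integer in $[1,D(I_k)]$ divides $t$.
   Context: A sequence over $G_0\subseteq\mathbb{Z}$ is a finite unordered list of elements of $G_0$ with repetition allowed; a subsequence is a sub-multiset; a sequence is zero-sum if its sum is $0$. $D(I_k)$ is the Davenport constant of $I_k$ (maximum length of a minimal zero-sum sequence over $I_k$), which equals $\max\{2,2k-1\}$. $\mathsf{s}'_t(I_k)$ is the smallest positive integer $\ell$ such that every zero-sum sequence over $I_k$ of length at least $\ell$ contains a zero-sum subsequence of length $t$; $\mathsf{s}'_t(I_k)=\infty$ if no such $\ell$ exists. -}

module Defs where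

open import Data.Nat using (ℕ; suc; _*_; _∸_; _⊔_; _≤_)
open import Data.Integer as ℤ using (ℤ; +_; -_)
open import Data.List using (List; length; foldr)
open import Data.List.Relation.Unary.All using (All)
open import Data.List.Relation.Binary.Sublist.Propositional using (_⊆_)
open import Data.Product using (∃; _×_)
open import Relation.Binary.PropositionalEquality using (_≡_)

InI : ℕ → ℤ → Set
InI k i = (- (+ k)) ℤ.≤ i × i ℤ.≤ + k

SeqOver : ℕ → List ℤ → Set
SeqOver k S = All (InI k) S

sumℤ : List ℤ → ℤ
sumℤ = foldr ℤ._+_ (+ 0)

ZeroSum : List ℤ → Set
ZeroSum S = sumℤ S ≡ + 0

-- T is a subsequence (sub-multiset) of S. Since sequences are unordered,
-- sub-multisets of S correspond exactly to sublists of the list S.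
Subseq : List ℤ → List ℤ → Set
Subseq T S = T ⊆ S

s'Property : ℕ → ℕ → ℕ → Set
s'Property k t ℓ = (S : List ℤ) → SeqOver k S → ZeroSum S → ℓ ≤ length S →
  ∃ λ T → Subseq T S × ZeroSum T × length T ≡ t

-- s'_t(I_k) is finite: some positive integer ℓ has the property
-- (then the smallest such ℓ exists, by well-ordering).
s'Finite : ℕ → ℕ → Set
s'Finite k t = ∃ λ ℓ → 1 ≤ ℓ × s'Property k t ℓ

D : ℕ → ℕ
D k = 2 ⊔ (2 * k ∸ 1)

-- Let m = 2j+1 ≤ D(I_k) ≤ 2k; then j+1 ≤ k. For every ℓ the sequence
-- (j+1)^{ℓj} (−j)^{ℓ(j+1)} over I_k is zero-sum of length ≥ ℓ. A zero-sum
-- subsequence of it with a copies of j+1 and b copies of −j satisfies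
-- a(j+1) = bj, hence (a+b)j = a(2j+1) and (a+b)(j+1) = b(2j+1), so m divides
-- their difference a+b, which is its length t.

module Submission where

open import Defs
open import Data.Nat using (ℕ; _≤_; _*_; _+_)
open import Data.Nat.Divisibility using (_∣_)
open import Data.Product using (∃)
open import Relation.Binary.PropositionalEquality using (_≡_)

open import Data.Nat using (zero; suc; _<_)
import Data.Nat.Properties as ℕ
open import Data.Nat.Divisibility using (divides; ∣m+n∣m⇒∣n)
open import Data.Nat.Tactic.RingSolver using (solve-∀)
open import Data.Integer as ℤ using (ℤ; +_; -_; 0ℤ; 1ℤ)
import Data.Integer.Properties as ℤ
import Data.Integer.Tactic.RingSolver as ℤ
open import Data.List using (List; []; _∷_; length; replicate; _++_)
open import Data.List.Properties using (length-++; length-replicate)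
open import Data.List.Relation.Unary.All as All using (All; []; _∷_)
open import Data.List.Relation.Unary.All.Properties using (++⁺; replicate⁺)
open import Data.List.Relation.Binary.Sublist.Propositional.Properties using (All-resp-⊆)
open import Data.Product using (_,_; _×_; ∃₂)
open import Data.Sum using (_⊎_; inj₁; inj₂)
open import Relation.Binary.PropositionalEquality using (refl; sym; trans; cong; cong₂; module ≡-Reasoning)
open ≡-Reasoning

sumℤ-++ : ∀ (xs ys : List ℤ) → sumℤ (xs ++ ys) ≡ sumℤ xs ℤ.+ sumℤ ys
sumℤ-++ []       ys = sym (ℤ.+-identityˡ (sumℤ ys))
sumℤ-++ (x ∷ xs) ys = trans (cong (λ s → x ℤ.+ s) (sumℤ-++ xs ys)) (sym (ℤ.+-assoc x (sumℤ xs) (sumℤ ys)))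

sumℤ-replicate : ∀ n (x : ℤ) → sumℤ (replicate n x) ≡ + n ℤ.* x
sumℤ-replicate zero    x = sym (ℤ.*-zeroˡ x)
sumℤ-replicate (suc n) x = trans (cong (λ s → x ℤ.+ s) (sumℤ-replicate n x)) (sym (ℤ.suc-* (+ n) x))

Over₂ : ℤ → ℤ → List ℤ → Set
Over₂ x y = All (λ e → e ≡ x ⊎ e ≡ y)

over₂-count : ∀ {x y} (T : List ℤ) → Over₂ x y T →
  ∃₂ λ a b → length T ≡ a + b × sumℤ T ≡ + a ℤ.* x ℤ.+ + b ℤ.* y
over₂-count {x} {y} [] [] = 0 , 0 , refl , sym (cong₂ ℤ._+_ (ℤ.*-zeroˡ x) (ℤ.*-zeroˡ y))
over₂-count {x} {y} (_ ∷ T) (inj₁ refl ∷ T∈) with over₂-count T T∈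
... | a , b , len , sum = suc a , b , cong suc len ,
  trans (cong (λ s → x ℤ.+ s) sum) (prepend (+ a) (+ b) x y)
  where
  prepend : ∀ a b x y → x ℤ.+ (a ℤ.* x ℤ.+ b ℤ.* y) ≡ (1ℤ ℤ.+ a) ℤ.* x ℤ.+ b ℤ.* y
  prepend = ℤ.solve-∀
over₂-count {x} {y} (_ ∷ T) (inj₂ refl ∷ T∈) with over₂-count T T∈
... | a , b , len , sum = a , suc b , trans (cong suc len) (sym (ℕ.+-suc a b)) ,
  trans (cong (λ s → y ℤ.+ s) sum) (prepend (+ a) (+ b) x y)
  where
  prepend : ∀ a b x y → y ℤ.+ (a ℤ.* x ℤ.+ b ℤ.* y) ≡ a ℤ.* x ℤ.+ (1ℤ ℤ.+ b) ℤ.* y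
  prepend = ℤ.solve-∀

replicate₂ : ℕ → ℤ → ℕ → ℤ → List ℤ
replicate₂ n x m y = replicate n x ++ replicate m y

replicate₂-over₂ : ∀ n x m y → Over₂ x y (replicate₂ n x m y)
replicate₂-over₂ n x m y = ++⁺ (replicate⁺ n (inj₁ refl)) (replicate⁺ m (inj₂ refl))

length-replicate₂ : ∀ n x m y → length (replicate₂ n x m y) ≡ n + m
length-replicate₂ n x m y =
  trans (length-++ (replicate n x)) (cong₂ _+_ (length-replicate n) (length-replicate m))

sumℤ-replicate₂ : ∀ n x m y → sumℤ (replicate₂ n x m y) ≡ + n ℤ.* x ℤ.+ + m ℤ.* y
sumℤ-replicate₂ n x m y =
  trans (sumℤ-++ (replicate n x) _) (cong₂ ℤ._+_ (sumℤ-replicate n x) (sumℤ-replicate m y))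

pos-InI : ∀ {p k} → p ≤ k → InI k (+ p)
pos-InI p≤k = ℤ.neg-≤-pos , ℤ.+≤+ p≤k

neg-InI : ∀ {q k} → q ≤ k → InI k (- + q)
neg-InI q≤k = ℤ.neg-mono-≤ (ℤ.+≤+ q≤k) , ℤ.neg-≤-pos

over₂-InI : ∀ {k x y S} → InI k x → InI k y → Over₂ x y S → SeqOver k S
over₂-InI x∈I y∈I = All.map λ { (inj₁ refl) → x∈I ; (inj₂ refl) → y∈I }

weighted-sum≡0⇒balanced : ∀ a p b q → + a ℤ.* + p ℤ.+ + b ℤ.* - + q ≡ 0ℤ → a * p ≡ b * q
weighted-sum≡0⇒balanced a p b q sum≡0 = ℤ.+-injective (ℤ.i-j≡0⇒i≡j (+ (a * p)) (+ (b * q)) (begin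
  + (a * p) ℤ.- + (b * q)          ≡⟨ cong₂ (λ u v → u ℤ.+ - v) (ℤ.pos-* a p) (ℤ.pos-* b q) ⟩
  + a ℤ.* + p ℤ.+ - (+ b ℤ.* + q)  ≡⟨ cong (λ v → + a ℤ.* + p ℤ.+ v) (ℤ.neg-distribʳ-* (+ b) (+ q)) ⟩
  + a ℤ.* + p ℤ.+ + b ℤ.* - + q    ≡⟨ sum≡0 ⟩
  0ℤ                               ∎))

a[j+1]≡bj⇒2j+1∣a+b : ∀ a b j → a * suc j ≡ b * j → 2 * j + 1 ∣ a + b
a[j+1]≡bj⇒2j+1∣a+b a b j a[j+1]≡bj = ∣m+n∣m⇒∣n ∣[a+b][j+1] ∣[a+b]j
  where
  ∣[a+b]j : 2 * j + 1 ∣ (a + b) * j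
  ∣[a+b]j = divides a (begin
    (a + b) * j          ≡⟨ ℕ.*-distribʳ-+ j a b ⟩
    a * j + b * j        ≡⟨ cong (λ u → a * j + u) (sym a[j+1]≡bj) ⟩
    a * j + a * suc j    ≡⟨ split a j ⟩
    a * (2 * j + 1)      ∎)
    where
    split : ∀ a j → a * j + a * suc j ≡ a * (2 * j + 1)
    split = solve-∀
  ∣[a+b][j+1] : 2 * j + 1 ∣ (a + b) * j + (a + b)
  ∣[a+b][j+1] = divides b (begin
    (a + b) * j + (a + b)  ≡⟨ split a b j ⟩
    a * suc j + b * j + b  ≡⟨ cong (λ u → u + b * j + b) a[j+1]≡bj ⟩
    b * j + b * j + b      ≡⟨ collect b j ⟩
    b * (2 * j + 1)        ∎)
    where
    split : ∀ a b j → (a + b) * j + (a + b) ≡ a * suc j + b * j + b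
    split = solve-∀
    collect : ∀ b j → b * j + b * j + b ≡ b * (2 * j + 1)
    collect = solve-∀

D≤2k : ∀ {k} → 1 ≤ k → D k ≤ 2 * k
D≤2k {k} 1≤k = ℕ.⊔-lub (ℕ.*-monoʳ-≤ 2 1≤k) (ℕ.m∸n≤m (2 * k) 1)

2j+1≤2k⇒j<k : ∀ {j k} → 2 * j + 1 ≤ 2 * k → j < k
2j+1≤2k⇒j<k {j} {k} le = ℕ.*-cancelˡ-< 2 j k (ℕ.≤-trans (ℕ.≤-reflexive (ℕ.+-comm 1 (2 * j))) le)

witness : ℕ → ℕ → List ℤ
witness ℓ j = replicate₂ (ℓ * j) (+ suc j) (ℓ * suc j) (- + j)

witness-over₂ : ∀ ℓ j → Over₂ (+ suc j) (- + j) (witness ℓ j)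
witness-over₂ ℓ j = replicate₂-over₂ (ℓ * j) (+ suc j) (ℓ * suc j) (- + j)

witness-zeroSum : ∀ ℓ j → ZeroSum (witness ℓ j)
witness-zeroSum ℓ j = begin
  sumℤ (witness ℓ j)
    ≡⟨ sumℤ-replicate₂ (ℓ * j) (+ suc j) (ℓ * suc j) (- + j) ⟩
  + (ℓ * j) ℤ.* + suc j ℤ.+ + (ℓ * suc j) ℤ.* - + j
    ≡⟨ cong₂ (λ u v → u ℤ.* + suc j ℤ.+ v ℤ.* - + j) (ℤ.pos-* ℓ j) (ℤ.pos-* ℓ (suc j)) ⟩
  (+ ℓ ℤ.* + j) ℤ.* (1ℤ ℤ.+ + j) ℤ.+ (+ ℓ ℤ.* (1ℤ ℤ.+ + j)) ℤ.* - + j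
    ≡⟨ cancel (+ ℓ) (+ j) ⟩
  0ℤ ∎
  where
  cancel : ∀ l j → (l ℤ.* j) ℤ.* (1ℤ ℤ.+ j) ℤ.+ (l ℤ.* (1ℤ ℤ.+ j)) ℤ.* - j ≡ 0ℤ
  cancel = ℤ.solve-∀

witness-length : ∀ ℓ j → ℓ ≤ length (witness ℓ j)
witness-length ℓ j = ℕ.≤-trans (ℕ.≤-trans (ℕ.m≤m*n ℓ (suc j)) (ℕ.m≤n+m (ℓ * suc j) (ℓ * j)))
  (ℕ.≤-reflexive (sym (length-replicate₂ (ℓ * j) (+ suc j) (ℓ * suc j) (- + j))))

lemma3p2 : (k t : ℕ) → 1 ≤ k → 1 ≤ t → s'Finite k t →
    (m : ℕ) → 1 ≤ m → m ≤ D k → (∃ λ j → m ≡ 2 * j + 1) → m ∣ t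
lemma3p2 k t 1≤k _ (ℓ , _ , s'ℓ) m _ m≤D (j , refl)
  with s'ℓ (witness ℓ j) (over₂-InI (pos-InI j<k) (neg-InI (ℕ.<⇒≤ j<k)) (witness-over₂ ℓ j))
           (witness-zeroSum ℓ j) (witness-length ℓ j)
  where
  j<k : j < k
  j<k = 2j+1≤2k⇒j<k (ℕ.≤-trans m≤D (D≤2k 1≤k))
... | T , T⊆S , T-zeroSum , refl with over₂-count T (All-resp-⊆ T⊆S (witness-over₂ ℓ j))
... | a , b , len , sum rewrite len =
  a[j+1]≡bj⇒2j+1∣a+b a b j (weighted-sum≡0⇒balanced a (suc j) b j (trans (sym sum) T-zeroSum))
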